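{- Let $H$ be any subgraph of a graph $G$ and let $L$ be a longest path in $G-H$, with vertices $u_1,\dots,u_m$. Let $\Upsilon$ be a $(U_0)$-minimal $L_H$-spreading. Then for each $u\in\overline U_0$, $$|L|\geq\varphi_u+b_u.$$
   Context: Graphs are finite, undirected, simple. $N(x)$ is the neighbourhood of $x$; $G-H$ is the subgraph induced by $V(G)\setminus V(H)$. The length $|L|$ of a path is its number of edges. Let $L$ be a path in $G-H$ with vertex set $\{u_1,\dots,u_m\}$. An $L_H$-spreading $\Upsilon$ is a family of pairwise vertex-disjoint paths $\Upsilon(u_1),\dots,\Upsilon(u_m)$ in $G-H$, where $\Upsilon(u_i)$ is a path starting at $u_i$ and ending at a vertex denoted $\ddot u_i$ (possibly $\ddot u_i=u_i$, a trivial path). If $u\neq\ddot u$, $\dot u$ denotes the successor of $u$ along $\Upsilon(u)$ (oriented from $u$ to $\ddot u$). Let $V(\Upsilon)=\bigcup_i V(\Upsilon(u_i))$. For $u\in V(L)$: $\Phi_u=N(\ddot u)\cap V(\Upsilon)$, $\varphi_u=|\Phi_u|$. Define $U_0=\{u\in V(L): u=\ddot u\}$ and $\overline U_0=V(L)\setminus U_0$. For $u\in\overline U_0$, $B_u=\{v\in U_0: v\dot u\in E(G)\}$ and $b_u=|B_u|$. An $L_H$-spreading is $(U_0)$-minimal if it minimizes $|U_0|$ among all $L_H$-spreadings. -}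

module Defs where

open import Data.Nat using (ℕ; _≤_; _<_; _∸_; _+_)
open import Data.Bool using (Bool; true; false)
import Data.Bool as B
open import Data.Fin using (Fin)
open import Data.Fin.Properties using (_≟_)
open import Data.Fin.Subset using (Subset) renaming (_∉_ to _∉ₛ_)
open import Data.List using (List; []; _∷_; length; filter; allFin)
open import Data.List.Membership.Propositional using (_∈_; _∉_)
import Data.List.Membership.DecPropositional as DecMem
open import Data.List.Relation.Unary.All using (All)
open import Data.List.Relation.Unary.Any using (Any; any?)
open import Data.List.Relation.Unary.Unique.Propositional using (Unique)
open import Data.List.Relation.Unary.Linked using (Linked)
open import Data.Product using (_×_; ∃)
open import Relation.Binary.PropositionalEquality using (_≡_; _≢_)
open import Relation.Nullary using (Dec; _×-dec_)
open import Relation.Unary using (Decidable)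

record Graph : Set where
  field
    n          : ℕ
    adj        : Fin n → Fin n → Bool
    adj-sym    : ∀ x y → adj x y ≡ adj y x
    adj-irrefl : ∀ x → adj x x ≡ false

module _ (G : Graph) where
  open Graph G
  open DecMem (_≟_ {n}) using (_∈?_)

  V : Set
  V = Fin n

  Edge : V → V → Set
  Edge x y = adj x y ≡ true

  Edge? : ∀ x y → Dec (Edge x y)
  Edge? x y = adj x y B.≟ true

  -- p (a list of vertices, in order) is a path in G - H, where H is
  -- given by its vertex set (G - H is induced on V(G) \ V(H)).
  record IsPath (H : Subset n) (p : List V) : Set where
    field
      nonEmpty : 0 < length p
      distinct : Unique p
      avoidsH  : All (λ x → x ∉ₛ H) p
      linked   : Linked Edge p

  pathLength : List V → ℕ
  pathLength p = length p ∸ 1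

  record IsLongestPath (H : Subset n) (L : List V) : Set where
    field
      isPath  : IsPath H L
      longest : ∀ P → IsPath H P → pathLength P ≤ pathLength L

  -- Υ assigns to each vertex u of L the path Υ(u) (values off V(L) are irrelevant).
  record IsSpreading (H : Subset n) (L : List V) (Υ : V → List V) : Set where
    field
      paths    : ∀ u → u ∈ L → IsPath H (Υ u)
      starts   : ∀ u → u ∈ L → ∃ λ rest → Υ u ≡ u ∷ rest
      disjoint : ∀ u v → u ∈ L → v ∈ L → u ≢ v → ∀ x → x ∈ Υ u → x ∉ Υ v

  lastOr : V → List V → V
  lastOr d []       = d
  lastOr d (x ∷ []) = x
  lastOr d (x ∷ y ∷ xs) = lastOr d (y ∷ xs)

  secondOr : V → List V → V
  secondOr d (x ∷ y ∷ _) = y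
  secondOr d _           = d

  endOf : (V → List V) → V → V
  endOf Υ u = lastOr u (Υ u)

  succOf : (V → List V) → V → V
  succOf Υ u = secondOr u (Υ u)

  count : (P : V → Set) → Decidable P → ℕ
  count P P? = length (filter P? (allFin n))

  InVΥ : List V → (V → List V) → V → Set
  InVΥ L Υ x = Any (λ u → x ∈ Υ u) L

  InVΥ? : ∀ L Υ → Decidable (InVΥ L Υ)
  InVΥ? L Υ x = any? (λ u → x ∈? Υ u) L

  φ : List V → (V → List V) → V → ℕ
  φ L Υ u = count (λ x → Edge (endOf Υ u) x × InVΥ L Υ x)
                  (λ x → Edge? (endOf Υ u) x ×-dec InVΥ? L Υ x)

  InU₀ : List V → (V → List V) → V → Set
  InU₀ L Υ x = x ∈ L × x ≡ endOf Υ x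

  InU₀? : ∀ L Υ → Decidable (InU₀ L Υ)
  InU₀? L Υ x = (x ∈? L) ×-dec (_≟_ {n} x (endOf Υ x))

  sizeU₀ : List V → (V → List V) → ℕ
  sizeU₀ L Υ = count (InU₀ L Υ) (InU₀? L Υ)

  b : List V → (V → List V) → V → ℕ
  b L Υ u = count (λ v → InU₀ L Υ v × Edge v (succOf Υ u))
                  (λ v → InU₀? L Υ v ×-dec Edge? v (succOf Υ u))

  record IsMinimalSpreading (H : Subset n) (L : List V) (Υ : V → List V) : Set where
    field
      spreading : IsSpreading H L Υ
      minimal   : ∀ Υ' → IsSpreading H L Υ' → sizeU₀ L Υ ≤ sizeU₀ L Υ'

module Submission where

-- Lemma 3.  Let L be a longest path of G − H, Υ an L_H-spreading and u ∈ V(L) with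
-- u ≠ ü, so Υ(u) = u, x₁, …, x_k with x_k = ü =: e and k ≥ 1.  Then φ_u + b_u ≤ |L|.
--
-- Idea.  Write L = l₀ … l_{m-1} and u = l_p.  The vertices counted by φ_u (neighbours y
-- of e in V(Υ)) and by b_u (vertices v ∈ U₀ adjacent to x₁) are the targets.  A target
-- gets a position r on L (the root l_r of the tooth containing y, resp. v itself) and an
-- offset c (the depth of y in that tooth, resp. k).  Since L is longest, a detour hanging
-- off l_r fits on both sides of r, and a detour between two vertices of L is shorter than
-- their distance on L.  Stems of targets joined through e and through x₁, …, e are such
-- detours; hence targets at distinct positions are separated: each offset is smaller than
-- the other plus the distance of the positions.  Consequently the slot map
-- (r, c) ↦ r - c, p - k + c, r + c (for r <, =, > p) injects the targets into
-- {0, …, m - 1} ∖ {p}, and φ_u + b_u ≤ m - 1 = |L|.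

open import Defs
open import Data.Nat using (ℕ; zero; suc; _+_; _∸_; _≤_; _<_; _<?_; z≤n; s≤s; s≤s⁻¹; ∣_-_∣)
open import Data.Nat.Properties renaming (_≟_ to _≟ℕ_)
open import Data.Fin.Properties using (_≟_)
open import Data.Fin.Subset using (Subset) renaming (_∉_ to _∉ₛ_)
open import Data.List using (List; []; _∷_; _++_; [_]; length; reverse; map; filter; allFin)
open import Data.List.Properties
  using (++-assoc; unfold-reverse; reverse-++; ∷-injective; ∷-injectiveʳ; length-++; length-reverse; length-map;
         filter-all; filter-accept; filter-reject)
open import Data.List.Membership.Propositional using (_∈_; _∉_)
open import Data.List.Membership.Propositional.Properties
  using (∈-++⁺ˡ; ∈-++⁺ʳ; ∈-++⁻; ∈-map⁻; ∈-filter⁻)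
import Data.List.Membership.DecPropositional as DecMembership
open import Data.List.Relation.Unary.Any using (Any; here; there)
import Data.List.Relation.Unary.Any.Properties as Any
open import Data.List.Relation.Unary.All as All using (All; []; _∷_)
import Data.List.Relation.Unary.All.Properties as All
open import Data.List.Relation.Unary.Unique.Propositional using (Unique; []; _∷_)
import Data.List.Relation.Unary.Unique.Propositional.Properties as Unique
open import Data.List.Relation.Unary.Linked using (Linked; []; [-]; _∷_)
open import Data.List.Relation.Binary.Disjoint.Propositional using (Disjoint)
import Data.List.Relation.Binary.Permutation.Setoid as Permutation
import Data.List.Relation.Binary.Permutation.Setoid.Properties as PermutationProperties
open import Data.Product using (_×_; _,_; proj₁; proj₂; ∃; ∃₂)
open import Data.Sum using (_⊎_; inj₁; inj₂)
open import Data.Sum.Properties using (inj₁-injective; inj₂-injective)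
open import Data.Empty using (⊥; ⊥-elim)
open import Function using (_∘_)
open import Relation.Nullary using (¬_; yes; no; _×-dec_)
open import Relation.Binary.Definitions using (DecidableEquality; tri<; tri≈; tri>)
open import Relation.Binary.PropositionalEquality hiding ([_])

module _ {A : Set} where

  open Permutation (setoid A) using (↭-sym)
  open PermutationProperties (setoid A) using (Unique-resp-↭; shifts; ↭-reverse)

  unique-∷ : ∀ {x} {xs : List A} → x ∉ xs → Unique xs → Unique (x ∷ xs)
  unique-∷ {x} {xs} x∉ u = All.tabulate (λ y∈ x≡y → x∉ (subst (_∈ xs) (sym x≡y) y∈)) ∷ u

  unique-∷⁻ : ∀ {x} {xs : List A} → Unique (x ∷ xs) → x ∉ xs × Unique xs
  unique-∷⁻ u@(_ ∷ u') = Unique.Unique[x∷xs]⇒x∉xs u , u'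

  unique-reverse : ∀ {xs : List A} → Unique xs → Unique (reverse xs)
  unique-reverse {xs} = Unique-resp-↭ (↭-sym (↭-reverse xs))

  unique-++⁻ : ∀ xs {ys : List A} → Unique (xs ++ ys) → Unique xs × Unique ys × Disjoint xs ys
  unique-++⁻ [] u = [] , u , λ ()
  unique-++⁻ (x ∷ xs) (x∉ ∷ u) with unique-++⁻ xs u
  ... | uxs , uys , disj =
    All.++⁻ˡ xs x∉ ∷ uxs , uys ,
    λ { (here refl , y∈ys) → All.lookup (All.++⁻ʳ xs x∉) y∈ys refl
      ; (there y∈xs , y∈ys) → disj (y∈xs , y∈ys) }

  unique-replace : ∀ xs {ys zs ys' : List A} → Unique (xs ++ ys ++ zs) → Unique ys' →
                   (∀ {v} → v ∈ ys' → v ∉ xs ++ ys ++ zs) → Unique (xs ++ ys' ++ zs)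
  unique-replace xs {ys} {zs} {ys'} u u' fresh = Unique-resp-↭ (shifts ys' xs) u'xz
    where
    uxz : Unique (xs ++ zs)
    uxz with unique-++⁻ ys (Unique-resp-↭ (shifts xs ys) u)
    ... | _ , uxz , _ = uxz
    keep : ∀ {v} → v ∈ xs ++ zs → v ∈ xs ++ ys ++ zs
    keep {v} v∈ with ∈-++⁻ xs v∈
    ... | inj₁ p = ∈-++⁺ˡ p
    ... | inj₂ p = ∈-++⁺ʳ xs (∈-++⁺ʳ ys p)
    u'xz : Unique (ys' ++ xs ++ zs)
    u'xz = Unique.++⁺ u' uxz (λ (p , q) → fresh p (keep q))

  all-reverse : ∀ {P : A → Set} {xs} → All P xs → All P (reverse xs)
  all-reverse pxs = All.tabulate (λ x∈ → All.lookup pxs (Any.reverse⁻ x∈))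

  reverse-between : ∀ (a : A) Z b → reverse (a ∷ Z ++ [ b ]) ≡ b ∷ reverse Z ++ [ a ]
  reverse-between a Z b = trans (unfold-reverse a (Z ++ [ b ])) (cong (_++ [ a ]) (reverse-++ Z [ b ]))

  module _ {R : A → A → Set} where

    linked-glue : ∀ xs {a ys} → Linked R (xs ++ [ a ]) → Linked R (a ∷ ys) → Linked R (xs ++ a ∷ ys)
    linked-glue []           _        l = l
    linked-glue (x ∷ [])     (r ∷ [-]) l = r ∷ l
    linked-glue (x ∷ y ∷ xs) (r ∷ l₁) l = r ∷ linked-glue (y ∷ xs) l₁ l

    linked-split : ∀ xs {a ys} → Linked R (xs ++ a ∷ ys) → Linked R (xs ++ [ a ]) × Linked R (a ∷ ys)
    linked-split []           l       = [-] , l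
    linked-split (x ∷ [])     (r ∷ l) = r ∷ [-] , l
    linked-split (x ∷ y ∷ xs) (r ∷ l) with linked-split (y ∷ xs) l
    ... | l₁ , l₂ = r ∷ l₁ , l₂

    linked-reverse : (∀ {x y} → R x y → R y x) → ∀ {xs} → Linked R xs → Linked R (reverse xs)
    linked-reverse R-sym []      = []
    linked-reverse R-sym [-]     = [-]
    linked-reverse R-sym {x ∷ y ∷ ys} (r ∷ l) =
      subst (Linked R) (sym reverse-unfolds)
            (linked-glue (reverse ys) (subst (Linked R) (unfold-reverse y ys) (linked-reverse R-sym l))
                         (R-sym r ∷ [-]))
      where
      reverse-unfolds : reverse (x ∷ y ∷ ys) ≡ reverse ys ++ y ∷ [ x ]
      reverse-unfolds = trans (unfold-reverse x (y ∷ ys))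
                              (trans (cong (_++ [ x ]) (unfold-reverse y ys)) (++-assoc (reverse ys) [ y ] [ x ]))

  split-same : ∀ (P P' : List A) {a a' Q Q'} → P ++ a ∷ Q ≡ P' ++ a' ∷ Q' → length P ≡ length P' → a ≡ a'
  split-same []      []        eq _  = proj₁ (∷-injective eq)
  split-same (_ ∷ P) (_ ∷ P') eq le = split-same P P' (∷-injectiveʳ eq) (suc-injective le)

  split-between : ∀ (P P' : List A) {a a' Q Q'} → P ++ a ∷ Q ≡ P' ++ a' ∷ Q' → length P < length P' →
                  ∃ λ M → Q ≡ M ++ a' ∷ Q' × length P' ≡ suc (length P + length M)
  split-between []      (_ ∷ P') refl _         = P' , refl , refl
  split-between (_ ∷ P) (_ ∷ P') eq   (s≤s lt) with split-between P P' (∷-injectiveʳ eq) lt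
  ... | M , eqQ , len = M , eqQ , cong suc len

  prefix-through : ∀ {w y : A} {rest} P {Q} → w ∷ rest ≡ P ++ y ∷ Q →
                   ∃ λ T → w ∷ T ≡ P ++ [ y ] × rest ≡ T ++ Q
  prefix-through []       refl = [] , refl , refl
  prefix-through {y = y} (p ∷ P) {Q} eq with ∷-injective eq
  ... | refl , rest≡ = P ++ [ y ] , refl , trans rest≡ (sym (++-assoc P [ y ] Q))

  module _ (_≟_ : DecidableEquality A) where

    indexOf : A → List A → ℕ
    indexOf x []       = 0
    indexOf x (y ∷ xs) with x ≟ y
    ... | yes _ = 0
    ... | no  _ = suc (indexOf x xs)

    indexOf-head : ∀ x xs → indexOf x (x ∷ xs) ≡ 0
    indexOf-head x xs with x ≟ x
    ... | yes _  = refl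
    ... | no x≢x = ⊥-elim (x≢x refl)

    indexOf-split : ∀ {x xs} → x ∈ xs → ∃₂ λ P Q → xs ≡ P ++ x ∷ Q × length P ≡ indexOf x xs
    indexOf-split {x} {y ∷ xs} x∈ with x ≟ y | x∈
    ... | yes refl | _ = [] , xs , refl , refl
    ... | no x≢y | here x≡y = ⊥-elim (x≢y x≡y)
    ... | no _   | there x∈xs with indexOf-split x∈xs
    ...   | P , Q , eq , len = y ∷ P , Q , cong (y ∷_) eq , cong suc len

    indexOf-injective : ∀ {x x' xs} → x ∈ xs → x' ∈ xs → indexOf x xs ≡ indexOf x' xs → x ≡ x'
    indexOf-injective x∈ x'∈ same with indexOf-split x∈ | indexOf-split x'∈
    ... | P , _ , eq , len | P' , _ , eq' , len' =
      split-same P P' (trans (sym eq) eq') (trans len (trans same (sym len')))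

unique-map : ∀ {A B : Set} (f : A → B) {xs : List A} →
             (∀ {x y} → x ∈ xs → y ∈ xs → f x ≡ f y → x ≡ y) → Unique xs → Unique (map f xs)
unique-map f {[]}     _   []         = []
unique-map f {x ∷ xs} inj (x∉ ∷ u) =
  All.tabulate (λ fy∈ fx≡fy → fresh fy∈ fx≡fy) ∷ unique-map f (λ p q → inj (there p) (there q)) u
  where
  fresh : ∀ {z} → z ∈ map f xs → f x ≡ z → ⊥
  fresh z∈ fx≡z with ∈-map⁻ f z∈
  ... | y , y∈ , refl = All.lookup x∉ y∈ (inj (here refl) (there y∈) fx≡z)

at-most-one-top : ∀ N {zs : List ℕ} → Unique zs → All (_< suc N) zs →
                  length zs ≤ suc (length (filter (_<? N) zs))
at-most-one-top N {[]}     _          _ = z≤n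
at-most-one-top N {z ∷ zs} (z∉ ∷ u) (z<1+N ∷ lt) with z <? N
... | yes z<N rewrite filter-accept (_<? N) {xs = zs} z<N = s≤s (at-most-one-top N u lt)
... | no  z≮N rewrite filter-reject (_<? N) {xs = zs} z≮N =
  s≤s (≤-reflexive (cong length (sym (filter-all (_<? N) rest-below))))
  where
  z≡N : z ≡ N
  z≡N = ≤-antisym (s≤s⁻¹ z<1+N) (≮⇒≥ z≮N)
  rest-below : All (_< N) zs
  rest-below = All.tabulate λ w∈ →
    ≤∧≢⇒< (s≤s⁻¹ (All.lookup lt w∈)) (λ w≡N → All.lookup z∉ w∈ (trans z≡N (sym w≡N)))

unique-below : ∀ N {zs : List ℕ} → Unique zs → All (_< N) zs → length zs ≤ N
unique-below zero    {[]}    _ _          = z≤n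
unique-below zero    {_ ∷ _} _ (() ∷ _)
unique-below (suc N) {zs}    u lt =
  ≤-trans (at-most-one-top N u lt)
          (s≤s (unique-below N (Unique.filter⁺ (_<? N) u) (All.all-filter (_<? N) zs)))

+-∣-∣ : ∀ {r r'} → r ≤ r' → r + ∣ r - r' ∣ ≡ r'
+-∣-∣ {r} {r'} r≤r' = trans (cong (r +_) (m≤n⇒∣m-n∣≡n∸m r≤r')) (m+[n∸m]≡n r≤r')

-- If r + a = r' + b, one of a, b is the other plus ∣ r - r' ∣, so they cannot both be
-- smaller than the other plus ∣ r - r' ∣.
balance : ∀ r r' {a b} → r + a ≡ r' + b → a < ∣ r - r' ∣ + b → b < ∣ r - r' ∣ + a → ⊥
balance r r' {a} {b} eq a< b< with ≤-total r r'
... | inj₁ r≤r' = <-irrefl a≡ a<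
  where
  a≡ : a ≡ ∣ r - r' ∣ + b
  a≡ = +-cancelˡ-≡ r a _ (trans eq (trans (cong (_+ b) (sym (+-∣-∣ r≤r'))) (+-assoc r _ b)))
... | inj₂ r'≤r = <-irrefl b≡ (subst (λ g → b < g + a) (∣-∣-comm r r') b<)
  where
  b≡ : b ≡ ∣ r' - r ∣ + a
  b≡ = +-cancelˡ-≡ r' b _ (trans (sym eq) (trans (cong (_+ a) (sym (+-∣-∣ r'≤r))) (+-assoc r' _ a)))

∸-rebalance : ∀ {r c r' c'} → c ≤ r → c' ≤ r' → r ∸ c ≡ r' ∸ c' → r + c' ≡ r' + c
∸-rebalance {r} {c} {r'} {c'} c≤r c'≤r' eq = begin
  r + c'             ≡⟨ cong (_+ c') (sym (m∸n+n≡m c≤r)) ⟩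
  r ∸ c + c + c'     ≡⟨ +-assoc (r ∸ c) c c' ⟩
  r ∸ c + (c + c')   ≡⟨ cong₂ _+_ eq (+-comm c c') ⟩
  r' ∸ c' + (c' + c) ≡⟨ +-assoc (r' ∸ c') c' c ⟨
  r' ∸ c' + c' + c   ≡⟨ cong (_+ c) (m∸n+n≡m c'≤r') ⟩
  r' + c             ∎
  where open ≡-Reasoning

below-gap : ∀ {a b g} c → a + b < g → a < g + c
below-gap {a} {b} {g} c a+b<g = ≤-trans (s≤s (m≤m+n a b)) (≤-trans a+b<g (m≤m+n g c))

distinct-gap : ∀ {r r'} c → r ≢ r' → c < ∣ r - r' ∣ + c
distinct-gap c r≢r' = m<n+m c (n≢0⇒n>0 (λ gap≡0 → r≢r' (∣m-n∣≡0⇒m≡n gap≡0)))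

module Slots (m p k : ℕ) (p<m : p < m) (k≤p : k ≤ p) where

  Separated : ℕ → ℕ → ℕ → ℕ → Set
  Separated r c r' c' = c < ∣ r - r' ∣ + c' × c' < ∣ r - r' ∣ + c

  data Place (r c : ℕ) : Set where
    before : r < p → c ≤ r → r + k < p + c → Place r c
    at     : r ≡ p → c < k → Place r c
    after  : p < r → r + c < m → Place r c

  place-off : ∀ {r c} → r ≢ p → c ≤ r → r + c < m → k < ∣ r - p ∣ + c → Place r c
  place-off {r} {c} r≢p c≤r r+c<m k< with <-cmp r p
  ... | tri< r<p _ _ = before r<p c≤r (subst (r + k <_) r+[gap+c]≡p+c (+-monoʳ-< r k<))
    where
    r+[gap+c]≡p+c : r + (∣ r - p ∣ + c) ≡ p + c
    r+[gap+c]≡p+c = trans (sym (+-assoc r _ c)) (cong (_+ c) (+-∣-∣ (<⇒≤ r<p)))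
  ... | tri≈ _ r≡p _ = ⊥-elim (r≢p r≡p)
  ... | tri> _ _ p<r = after p<r r+c<m

  -- The slot in {0, …, m - 1} assigned to a target: before-targets land below p ∸ k,
  -- at-targets in [p ∸ k, p), after-targets above p.
  slot : ℕ → ℕ → ℕ
  slot r c with <-cmp r p
  ... | tri< _ _ _ = r ∸ c
  ... | tri≈ _ _ _ = p ∸ k + c
  ... | tri> _ _ _ = r + c

  slot-before : ∀ {r c} → r < p → slot r c ≡ r ∸ c
  slot-before {r} r<p with <-cmp r p
  ... | tri< _ _ _   = refl
  ... | tri≈ r≮p _ _ = ⊥-elim (r≮p r<p)
  ... | tri> r≮p _ _ = ⊥-elim (r≮p r<p)

  slot-at : ∀ {r c} → r ≡ p → slot r c ≡ p ∸ k + c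
  slot-at {r} r≡p with <-cmp r p
  ... | tri< _ r≢p _ = ⊥-elim (r≢p r≡p)
  ... | tri≈ _ _ _   = refl
  ... | tri> _ r≢p _ = ⊥-elim (r≢p r≡p)

  slot-after : ∀ {r c} → p < r → slot r c ≡ r + c
  slot-after {r} p<r with <-cmp r p
  ... | tri< _ _ p≮r = ⊥-elim (p≮r p<r)
  ... | tri≈ _ _ p≮r = ⊥-elim (p≮r p<r)
  ... | tri> _ _ _   = refl

  before-slot< : ∀ {r c} → r < p → c ≤ r → r + k < p + c → slot r c < p ∸ k
  before-slot< {r} {c} r<p c≤r r+k<p+c rewrite slot-before {r} {c} r<p =
    m+n≤o⇒m≤o∸n (suc (r ∸ c)) (+-cancelʳ-< c (r ∸ c + k) p (begin-strict
      r ∸ c + k + c  ≡⟨ +-assoc (r ∸ c) k c ⟩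
      r ∸ c + (k + c) ≡⟨ cong (r ∸ c +_) (+-comm k c) ⟩
      r ∸ c + (c + k) ≡⟨ +-assoc (r ∸ c) c k ⟨
      r ∸ c + c + k  ≡⟨ cong (_+ k) (m∸n+n≡m c≤r) ⟩
      r + k          <⟨ r+k<p+c ⟩
      p + c          ∎))
    where open ≤-Reasoning

  at-slot : ∀ {r c} → r ≡ p → c < k → p ∸ k ≤ slot r c × slot r c < p
  at-slot {r} {c} r≡p c<k rewrite slot-at {r} {c} r≡p =
    m≤m+n (p ∸ k) c , subst (p ∸ k + c <_) (m∸n+n≡m k≤p) (+-monoʳ-< (p ∸ k) c<k)

  after-slot : ∀ {r c} → p < r → r + c < m → p < slot r c × slot r c < m
  after-slot {r} {c} p<r r+c<m rewrite slot-after {r} {c} p<r = <-≤-trans p<r (m≤m+n r c) , r+c<m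

  slot-range : ∀ {r c} → Place r c → slot r c < m × slot r c ≢ p
  slot-range (before r<p c≤r bal) = <-trans s<p p<m , <⇒≢ s<p
    where s<p = <-≤-trans (before-slot< r<p c≤r bal) (m∸n≤m p k)
  slot-range (at r≡p c<k)         = <-trans (proj₂ (at-slot r≡p c<k)) p<m , <⇒≢ (proj₂ (at-slot r≡p c<k))
  slot-range (after p<r r+c<m)    = proj₂ (after-slot p<r r+c<m) , >⇒≢ (proj₁ (after-slot p<r r+c<m))

  private
    before<at : ∀ {r c r' c'} → r < p → c ≤ r → r + k < p + c → r' ≡ p → c' < k → slot r c < slot r' c'
    before<at r<p c≤r bal r'≡p c'<k = <-≤-trans (before-slot< r<p c≤r bal) (proj₁ (at-slot r'≡p c'<k))

    before<after : ∀ {r c r' c'} → r < p → c ≤ r → r + k < p + c → p < r' → r' + c' < m →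
                   slot r c < slot r' c'
    before<after r<p c≤r bal p<r' r'+c'<m =
      <-trans (<-≤-trans (before-slot< r<p c≤r bal) (m∸n≤m p k)) (proj₁ (after-slot p<r' r'+c'<m))

    at<after : ∀ {r c r' c'} → r ≡ p → c < k → p < r' → r' + c' < m → slot r c < slot r' c'
    at<after r≡p c<k p<r' r'+c'<m = <-trans (proj₂ (at-slot r≡p c<k)) (proj₁ (after-slot p<r' r'+c'<m))

  before-injective : ∀ {r c r' c'} → c ≤ r → c' ≤ r' → (r ≢ r' → Separated r c r' c') →
                     r ∸ c ≡ r' ∸ c' → r ≡ r' × c ≡ c'
  before-injective {r} {c} {r'} {c'} c≤r c'≤r' sep eq with r ≟ℕ r'
  ... | yes refl = refl , ∸-cancelˡ-≡ c≤r c'≤r' eq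
  ... | no  r≢r' = ⊥-elim (balance r r' (∸-rebalance c≤r c'≤r' eq) (proj₂ (sep r≢r')) (proj₁ (sep r≢r')))

  after-injective : ∀ {r c r' c'} → (r ≢ r' → Separated r c r' c') → r + c ≡ r' + c' → r ≡ r' × c ≡ c'
  after-injective {r} {c} {r'} {c'} sep eq with r ≟ℕ r'
  ... | yes refl = refl , +-cancelˡ-≡ r c c' eq
  ... | no  r≢r' = ⊥-elim (balance r r' eq (proj₁ (sep r≢r')) (proj₂ (sep r≢r')))

  slot-injective : ∀ {r c r' c'} → Place r c → Place r' c' →
                   (r ≢ p → r' ≢ p → r ≢ r' → Separated r c r' c') →
                   slot r c ≡ slot r' c' → r ≡ r' × c ≡ c'
  slot-injective (before r<p c≤r _) (before r'<p c'≤r' _) sep eq =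
    before-injective c≤r c'≤r' (sep (<⇒≢ r<p) (<⇒≢ r'<p))
                     (trans (sym (slot-before r<p)) (trans eq (slot-before r'<p)))
  slot-injective {c = c} {c' = c'} (at r≡p _) (at r'≡p _) _ eq =
    trans r≡p (sym r'≡p) , +-cancelˡ-≡ (p ∸ k) c c' (trans (sym (slot-at r≡p)) (trans eq (slot-at r'≡p)))
  slot-injective (after p<r _) (after p<r' _) sep eq =
    after-injective (sep (>⇒≢ p<r) (>⇒≢ p<r')) (trans (sym (slot-after p<r)) (trans eq (slot-after p<r')))
  slot-injective (before r<p c≤r bal) (at r'≡p c'<k) _ eq =
    ⊥-elim (<⇒≢ (before<at r<p c≤r bal r'≡p c'<k) eq)
  slot-injective (before r<p c≤r bal) (after p<r' bd) _ eq =
    ⊥-elim (<⇒≢ (before<after r<p c≤r bal p<r' bd) eq)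
  slot-injective (at r≡p c<k) (after p<r' bd) _ eq =
    ⊥-elim (<⇒≢ (at<after r≡p c<k p<r' bd) eq)
  slot-injective (at r≡p c<k) (before r'<p c'≤r' bal) _ eq =
    ⊥-elim (<⇒≢ (before<at r'<p c'≤r' bal r≡p c<k) (sym eq))
  slot-injective (after p<r bd) (before r'<p c'≤r' bal) _ eq =
    ⊥-elim (<⇒≢ (before<after r'<p c'≤r' bal p<r bd) (sym eq))
  slot-injective (after p<r bd) (at r'≡p c'<k) _ eq =
    ⊥-elim (<⇒≢ (at<after r'≡p c'<k p<r bd) (sym eq))

  placed-count : ∀ {A : Set} (ts : List A) (r c : A → ℕ) → Unique ts →
    (∀ {t} → t ∈ ts → Place (r t) (c t)) →
    (∀ {t t'} → t ∈ ts → t' ∈ ts → r t ≢ p → r t' ≢ p → r t ≢ r t' →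
                c t < ∣ r t - r t' ∣ + c t') →
    (∀ {t t'} → t ∈ ts → t' ∈ ts → r t ≡ r t' → c t ≡ c t' → t ≡ t') →
    length ts ≤ m ∸ 1
  placed-count {A} ts r c u place sep same =
    subst (_≤ m ∸ 1) (length-map slotOf ts)
          (∸-monoˡ-≤ 1 (unique-below m (p∉slots ∷ unique-slots) (p<m ∷ slots<m)))
    where
    slotOf : A → ℕ
    slotOf t = slot (r t) (c t)
    separated : ∀ {t t'} → t ∈ ts → t' ∈ ts → r t ≢ p → r t' ≢ p → r t ≢ r t' →
                Separated (r t) (c t) (r t') (c t')
    separated {t} {t'} t∈ t'∈ r≢p r'≢p r≢r' =
      sep t∈ t'∈ r≢p r'≢p r≢r' ,
      subst (λ g → c t' < g + c t) (∣-∣-comm (r t') (r t)) (sep t'∈ t∈ r'≢p r≢p (λ eq → r≢r' (sym eq)))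
    unique-slots : Unique (map slotOf ts)
    unique-slots = unique-map slotOf (λ t∈ t'∈ eq →
      let r≡ , c≡ = slot-injective (place t∈) (place t'∈) (separated t∈ t'∈) eq in same t∈ t'∈ r≡ c≡) u
    slots<m : All (_< m) (map slotOf ts)
    slots<m = All.tabulate λ s∈ → let t , t∈ , s≡ = ∈-map⁻ slotOf s∈ in
      subst (_< m) (sym s≡) (proj₁ (slot-range (place t∈)))
    p∉slots : All (p ≢_) (map slotOf ts)
    p∉slots = All.tabulate λ s∈ p≡s → let t , t∈ , s≡ = ∈-map⁻ slotOf s∈ in
      proj₂ (slot-range (place t∈)) (trans (sym s≡) (sym p≡s))

-- Surgery on a longest path L of G − H: detours from L cannot make it longer.
module Paths (G : Graph) (H : Subset (Graph.n G)) where

  open Graph G using (adj-sym; adj-irrefl)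

  private
    E : V G → V G → Set
    E = Edge G

  edge-sym : ∀ {x y} → E x y → E y x
  edge-sym {x} {y} xy = trans (adj-sym y x) xy

  edge-irrefl : ∀ {x} → ¬ E x x
  edge-irrefl {x} xx with trans (sym xx) (adj-irrefl x)
  ... | ()

  reverse-path : ∀ {P} → IsPath G H P → IsPath G H (reverse P)
  reverse-path {P} isP = record
    { nonEmpty = subst (0 <_) (sym (length-reverse P)) nonEmpty
    ; distinct = unique-reverse distinct
    ; avoidsH  = all-reverse avoidsH
    ; linked   = linked-reverse edge-sym linked
    }
    where open IsPath isP

  reverse-longest : ∀ {L} → IsLongestPath G H L → IsLongestPath G H (reverse L)
  reverse-longest {L} lp = record
    { isPath  = reverse-path isPath
    ; longest = λ P isP → subst (pathLength G P ≤_) (cong (_∸ 1) (sym (length-reverse L))) (longest P isP)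
    }
    where open IsLongestPath lp

  Outside : List (V G) → V G → Set
  Outside L x = x ∉ₛ H × x ∉ L

  record Detour (L Z : List (V G)) : Set where
    field
      distinct : Unique Z
      outside  : All (Outside L) Z

  detour-reverse : ∀ {L Z} → Detour L Z → Detour L (reverse Z)
  detour-reverse d = record { distinct = unique-reverse distinct ; outside = all-reverse outside }
    where open Detour d

  detour-++ : ∀ {L Z Z'} → Detour L Z → Detour L Z' → Disjoint Z Z' → Detour L (Z ++ Z')
  detour-++ d d' Z#Z' = record
    { distinct = Unique.++⁺ (Detour.distinct d) (Detour.distinct d') Z#Z'
    ; outside  = All.++⁺ (Detour.outside d) (Detour.outside d') }

  detour-prefix : ∀ {L} Z {Z'} → Detour L (Z ++ Z') → Detour L Z
  detour-prefix Z d = record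
    { distinct = proj₁ (unique-++⁻ Z (Detour.distinct d)) ; outside = All.++⁻ˡ Z (Detour.outside d) }

  detour-flip : ∀ {L Z} → Detour L Z → Detour (reverse L) Z
  detour-flip {L} d = record { distinct = distinct ; outside = All.map flip outside }
    where
    open Detour d
    flip : ∀ {x} → Outside L x → Outside (reverse L) x
    flip (x∉H , x∉L) = x∉H , λ x∈ → x∉L (Any.reverse⁻ x∈)

  no-longer : ∀ {L P} → IsLongestPath G H L → Unique P → All (_∉ₛ H) P → Linked E P → length P ≤ length L
  no-longer {L} {[]}    _  _ _ _ = z≤n
  no-longer {L} {x ∷ P} lp u h l
    with IsLongestPath.longest lp (x ∷ P) (record { nonEmpty = s≤s z≤n ; distinct = u ; avoidsH = h ; linked = l })
  ... | le with length L | IsPath.nonEmpty (IsLongestPath.isPath lp)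
  ...   | suc _ | _ = s≤s le

  extend-end : ∀ {L A w R T} → IsLongestPath G H L → L ≡ A ++ w ∷ R → Detour L T → Linked E (w ∷ T) →
               length T ≤ length R
  extend-end {A = A} {w} {R} {T} lp refl det lT =
    +-cancelˡ-≤ (suc (length A)) _ _ (subst₂ _≤_ (len T) (len R) (no-longer lp uP hP lP))
    where
    open IsPath (IsLongestPath.isPath lp)
    open Detour det renaming (distinct to T-distinct)
    len : ∀ X → length (A ++ w ∷ X) ≡ suc (length A) + length X
    len X = trans (length-++ A) (+-suc (length A) (length X))
    uP : Unique (A ++ w ∷ T)
    uP with unique-++⁻ A distinct
    ... | uA , _ , A#wR = Unique.++⁺ uA (unique-∷ w∉T T-distinct) A#wT
      where
      w∉T : w ∉ T
      w∉T w∈T = proj₂ (All.lookup outside w∈T) (∈-++⁺ʳ A (here refl))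
      A#wT : Disjoint A (w ∷ T)
      A#wT (v∈A , here refl)  = A#wR (v∈A , here refl)
      A#wT (v∈A , there v∈T) = proj₂ (All.lookup outside v∈T) (∈-++⁺ˡ v∈A)
    hP : All (_∉ₛ H) (A ++ w ∷ T)
    hP = All.++⁺ (All.++⁻ˡ A avoidsH) (All.head (All.++⁻ʳ A avoidsH) ∷ All.map proj₁ outside)
    lP : Linked E (A ++ w ∷ T)
    lP = linked-glue A (proj₁ (linked-split A linked)) lT

  extend-start : ∀ {L A w R T} → IsLongestPath G H L → L ≡ A ++ w ∷ R → Detour L T → Linked E (w ∷ T) →
                 length T ≤ length A
  extend-start {A = A} {w} {R} {T} lp refl det lT =
    subst (length T ≤_) (length-reverse A) (extend-end (reverse-longest lp) reversed (detour-flip det) lT)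
    where
    reversed : reverse (A ++ w ∷ R) ≡ reverse R ++ w ∷ reverse A
    reversed = trans (reverse-++ A (w ∷ R))
                     (trans (cong (_++ reverse A) (unfold-reverse w R)) (++-assoc (reverse R) [ w ] (reverse A)))

  splice : ∀ {L A a M b R Z} → IsLongestPath G H L → L ≡ A ++ a ∷ M ++ b ∷ R → Detour L Z →
           Linked E (a ∷ Z ++ [ b ]) → length Z ≤ length M
  splice {A = A} {a} {M} {b} {R} {Z} lp refl det lZ =
    +-cancelʳ-≤ (suc (length R)) _ _
      (s≤s⁻¹ (+-cancelˡ-≤ (length A) _ _ (subst₂ _≤_ (len Z) (len M) (no-longer lp uP hP lP))))
    where
    open IsPath (IsLongestPath.isPath lp)
    open Detour det renaming (distinct to Z-distinct)
    len : ∀ X → length (A ++ a ∷ X ++ b ∷ R) ≡ length A + suc (length X + suc (length R))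
    len X = trans (length-++ A) (cong (λ t → length A + suc t) (length-++ X))
    reassoc : ∀ X → (A ++ [ a ]) ++ X ++ b ∷ R ≡ A ++ a ∷ X ++ b ∷ R
    reassoc X = ++-assoc A [ a ] (X ++ b ∷ R)
    uP : Unique (A ++ a ∷ Z ++ b ∷ R)
    uP = subst Unique (reassoc Z)
           (unique-replace (A ++ [ a ]) (subst Unique (sym (reassoc M)) distinct) Z-distinct
              (λ v∈Z v∈L → proj₂ (All.lookup outside v∈Z) (subst (_ ∈_) (reassoc M) v∈L)))
    hP : All (_∉ₛ H) (A ++ a ∷ Z ++ b ∷ R)
    hP with All.++⁻ A avoidsH
    ... | hA , ha ∷ hMbR = All.++⁺ hA (ha ∷ All.++⁺ (All.map proj₁ outside) (All.++⁻ʳ M hMbR))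
    lP : Linked E (A ++ a ∷ Z ++ b ∷ R)
    lP with linked-split A linked
    ... | lAa , laMbR = linked-glue A lAa (linked-glue (a ∷ Z) lZ (proj₂ (linked-split (a ∷ M) laMbR)))

  module Positions {L} (lp : IsLongestPath G H L) where

    pos : V G → ℕ
    pos x = indexOf _≟_ x L

    pos-injective : ∀ {a b} → a ∈ L → b ∈ L → pos a ≡ pos b → a ≡ b
    pos-injective = indexOf-injective _≟_

    tail-bounds : ∀ {w T} → w ∈ L → Detour L T → Linked E (w ∷ T) →
                  length T ≤ pos w × pos w + length T < length L
    tail-bounds {w} {T} w∈ det lT with indexOf-split _≟_ w∈
    ... | A , R , L≡ , lenA =
      subst (length T ≤_) lenA (extend-start lp L≡ det lT) ,
      subst₂ _<_ (cong (_+ length T) lenA) (sym (trans (cong length L≡) (length-++ A)))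
             (+-monoʳ-< (length A) (s≤s (extend-end lp L≡ det lT)))

    detour-gap-ordered : ∀ {a b Z} → a ∈ L → b ∈ L → pos a < pos b → Detour L Z →
                         Linked E (a ∷ Z ++ [ b ]) → length Z < ∣ pos a - pos b ∣
    detour-gap-ordered {a} {b} {Z} a∈ b∈ a<b det lZ with indexOf-split _≟_ a∈ | indexOf-split _≟_ b∈
    ... | A , Q , L≡AaQ , lenA | B , R , L≡BbR , lenB
      with split-between A B (trans (sym L≡AaQ) L≡BbR) (subst₂ _<_ (sym lenA) (sym lenB) a<b)
    ...   | M , Q≡MbR , lenB≡ =
      subst (length Z <_) distance (s≤s (splice lp (trans L≡AaQ (cong (λ X → A ++ a ∷ X) Q≡MbR)) det lZ))
      where
      distance : suc (length M) ≡ ∣ pos a - pos b ∣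
      distance = begin
        suc (length M)                           ≡⟨ ∣m-m+n∣≡n (length A) (suc (length M)) ⟨
        ∣ length A - length A + suc (length M) ∣ ≡⟨ cong (λ t → ∣ length A - t ∣) (+-suc (length A) (length M)) ⟩
        ∣ length A - suc (length A + length M) ∣ ≡⟨ cong (λ t → ∣ length A - t ∣) lenB≡ ⟨
        ∣ length A - length B ∣                  ≡⟨ cong₂ ∣_-_∣ lenA lenB ⟩
        ∣ pos a - pos b ∣                        ∎
        where open ≡-Reasoning

    detour-gap : ∀ {a b Z} → a ∈ L → b ∈ L → a ≢ b → Detour L Z → Linked E (a ∷ Z ++ [ b ]) →
                 length Z < ∣ pos a - pos b ∣
    detour-gap {a} {b} {Z} a∈ b∈ a≢b det lZ with <-cmp (pos a) (pos b)
    ... | tri< a<b _ _ = detour-gap-ordered a∈ b∈ a<b det lZ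
    ... | tri≈ _ same _ = ⊥-elim (a≢b (pos-injective a∈ b∈ same))
    ... | tri> _ _ b<a = subst₂ _<_ (length-reverse Z) (∣-∣-comm (pos b) (pos a))
                           (detour-gap-ordered b∈ a∈ b<a (detour-reverse det)
                              (subst (Linked E) (reverse-between a Z b) (linked-reverse edge-sym lZ)))

lastOr-∈ : ∀ (G : Graph) d x (xs : List (V G)) → lastOr G d (x ∷ xs) ∈ x ∷ xs
lastOr-∈ G d x []       = here refl
lastOr-∈ G d x (z ∷ zs) = there (lastOr-∈ G d z zs)

last-split : ∀ (G : Graph) d x (xs : List (V G)) → ∃ λ P → x ∷ xs ≡ P ++ [ lastOr G d (x ∷ xs) ]
last-split G d x []       = [] , refl
last-split G d x (y ∷ ys) with last-split G d y ys
... | P , eq = x ∷ P , cong (x ∷_) eq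

nontrivial-tooth : ∀ (G : Graph) {u} (xs : List (V G)) → (∃ λ rest → xs ≡ u ∷ rest) → u ≢ lastOr G u xs →
                   ∃₂ λ X' X₀ → xs ≡ u ∷ secondOr G u xs ∷ X'
                              × secondOr G u xs ∷ X' ≡ X₀ ++ [ lastOr G u xs ]
nontrivial-tooth G _ ([]     , refl) u≢ü = ⊥-elim (u≢ü refl)
nontrivial-tooth G _ (y ∷ ys , refl) _   with last-split G _ y ys
... | X₀ , X≡ = ys , X₀ , refl , X≡

-- Teeth, roots, depths and stems of an L_H-spreading Υ.
module Spreading (G : Graph) (H : Subset (Graph.n G)) {L : List (V G)} {Υ : V G → List (V G)}
                 (sp : IsSpreading G H L Υ) where

  open Paths G H
  open DecMembership (_≟_ {Graph.n G}) using (_∈?_)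
  open IsSpreading sp

  private
    E : V G → V G → Set
    E = Edge G

  tooth-path : ∀ {w} → w ∈ L → IsPath G H (Υ w)
  tooth-path {w} w∈ = paths w w∈

  root∈tooth : ∀ {w} → w ∈ L → w ∈ Υ w
  root∈tooth {w} w∈ with starts w w∈
  ... | _ , Υw≡ = subst (w ∈_) (sym Υw≡) (here refl)

  tail-detour : ∀ {w rest} → w ∈ L → Υ w ≡ w ∷ rest → Detour L rest
  tail-detour {w} {rest} w∈ Υw≡ = record
    { distinct = proj₂ (unique-∷⁻ w-rest-unique)
    ; outside  = All.tabulate λ x∈ → All.lookup (All.tail avoids) x∈ , off-L x∈ }
    where
    open IsPath (tooth-path w∈) renaming (distinct to Υw-distinct)
    w-rest-unique : Unique (w ∷ rest)
    w-rest-unique = subst Unique Υw≡ Υw-distinct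
    avoids : All (_∉ₛ H) (w ∷ rest)
    avoids = subst (All _) Υw≡ avoidsH
    off-L : ∀ {x} → x ∈ rest → x ∉ L
    off-L {x} x∈ x∈L with x ≟ w
    ... | yes refl = proj₁ (unique-∷⁻ w-rest-unique) x∈
    ... | no x≢w = disjoint w x w∈ x∈L (λ w≡x → x≢w (sym w≡x)) x
                            (subst (x ∈_) (sym Υw≡) (there x∈)) (root∈tooth x∈L)

  rootIn : List (V G) → V G → V G
  rootIn []       y = y
  rootIn (w ∷ ws) y with y ∈? Υ w
  ... | yes _ = w
  ... | no  _ = rootIn ws y

  rootIn-spec : ∀ {y} ws → Any (λ w → y ∈ Υ w) ws → rootIn ws y ∈ ws × y ∈ Υ (rootIn ws y)
  rootIn-spec {y} (w ∷ ws) y∈ with y ∈? Υ w | y∈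
  ... | yes y∈Υw | _           = here refl , y∈Υw
  ... | no  y∉Υw | here y∈Υw   = ⊥-elim (y∉Υw y∈Υw)
  ... | no  _    | there y∈ws with rootIn-spec ws y∈ws
  ...   | r∈ , y∈Υr = there r∈ , y∈Υr

  root : V G → V G
  root = rootIn L

  root-spec : ∀ {y} → InVΥ G L Υ y → root y ∈ L × y ∈ Υ (root y)
  root-spec = rootIn-spec L

  depth : V G → ℕ
  depth y = indexOf _≟_ y (Υ (root y))

  root-depth-injective : ∀ {y y'} → InVΥ G L Υ y → InVΥ G L Υ y' →
                         root y ≡ root y' → depth y ≡ depth y' → y ≡ y'
  root-depth-injective {y} {y'} iy iy' r≡r' d≡d' =
    indexOf-injective _≟_ (proj₂ (root-spec iy)) (subst (λ w → y' ∈ Υ w) (sym r≡r') (proj₂ (root-spec iy')))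
                      (trans d≡d' (cong (λ w → indexOf _≟_ y' (Υ w)) (sym r≡r')))

  trivial-tooth : ∀ {v} → InU₀ G L Υ v → Υ v ≡ [ v ]
  trivial-tooth {v} (v∈ , v≡end) with starts v v∈
  ... | []     , Υv≡ = Υv≡
  ... | y ∷ ys , Υv≡ = ⊥-elim (proj₁ (unique-∷⁻ v-ys-unique) v∈ys)
    where
    v-ys-unique : Unique (v ∷ y ∷ ys)
    v-ys-unique = subst Unique Υv≡ (IsPath.distinct (tooth-path v∈))
    v∈ys : v ∈ y ∷ ys
    v∈ys = subst (_∈ y ∷ ys) (sym (trans v≡end (cong (lastOr G v) Υv≡))) (lastOr-∈ G v y ys)

  record Stem (y : V G) : Set where
    field
      T       : List (V G)
      S       : List (V G)
      ends    : root y ∷ T ≡ S ++ [ y ]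
      linked  : Linked E (S ++ [ y ])
      detour  : Detour L T
      inside  : All (_∈ Υ (root y)) T
      length≡ : length T ≡ depth y

  stem : ∀ {y} → InVΥ G L Υ y → Stem y
  stem {y} iy with root-spec iy
  ... | r∈ , y∈ with indexOf-split _≟_ y∈ | starts (root y) r∈
  ...   | P , Q , Υr≡PyQ , lenP | rest , Υr≡ with prefix-through P (trans (sym Υr≡) Υr≡PyQ)
  ...     | T , ends , rest≡ = record
    { T       = T
    ; S       = P
    ; ends    = ends
    ; linked  = proj₁ (linked-split P (subst (Linked E) Υr≡PyQ (IsPath.linked (tooth-path r∈))))
    ; detour  = detour-prefix T (subst (Detour L) rest≡ (tail-detour r∈ Υr≡))
    ; inside  = All.tabulate λ x∈T →
                  subst (_ ∈_) (sym Υr≡) (there (subst (_ ∈_) (sym rest≡) (∈-++⁺ˡ x∈T)))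
    ; length≡ = trans (suc-injective (trans (cong length ends) (trans (length-++ P) (+-comm (length P) 1)))) lenP
    }

module Lemma3 (G : Graph) (H : Subset (Graph.n G)) {L : List (V G)} {Υ : V G → List (V G)}
           (lp : IsLongestPath G H L) (sp : IsSpreading G H L Υ)
           {u : V G} (u∈L : u ∈ L) (u≢ü : u ≢ endOf G Υ u) {X' X₀ : List (V G)}
           (Υu≡ : Υ u ≡ u ∷ succOf G Υ u ∷ X') (X≡ : succOf G Υ u ∷ X' ≡ X₀ ++ [ endOf G Υ u ]) where

  open Paths G H
  open Spreading G H sp
  open Positions lp
  open IsSpreading sp

  private
    E : V G → V G → Set
    E = Edge G

  x₁ e : V G
  x₁ = succOf G Υ u
  e  = endOf G Υ u

  X : List (V G)
  X = x₁ ∷ X'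

  k : ℕ
  k = length X

  k≡ : k ≡ suc (length X₀)
  k≡ = trans (cong length X≡) (trans (length-++ X₀) (+-comm (length X₀) 1))

  X-detour : Detour L X
  X-detour = tail-detour u∈L Υu≡

  X⊆Υu : ∀ {x} → x ∈ X → x ∈ Υ u
  X⊆Υu x∈ = subst (_ ∈_) (sym Υu≡) (there x∈)

  e∈X : e ∈ X
  e∈X = subst (e ∈_) (sym X≡) (∈-++⁺ʳ X₀ (here refl))

  u-linked : Linked E (u ∷ X)
  u-linked = subst (Linked E) Υu≡ (IsPath.linked (tooth-path u∈L))

  u-x₁ : E u x₁
  u-x₁ with u-linked
  ... | ux₁ ∷ _ = ux₁

  record Spoke (a : V G) (Z : List (V G)) : Set where
    field
      detour : Detour L (Z ++ [ e ])
      linked : Linked E (a ∷ Z ++ [ e ])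

  neighbour-linked : ∀ {v} → E v x₁ → Linked E (v ∷ X)
  neighbour-linked vx₁ with u-linked
  ... | _ ∷ x-linked = vx₁ ∷ x-linked

  neighbour-spoke : ∀ {v} → E v x₁ → Spoke v X₀
  neighbour-spoke vx₁ = record
    { detour = subst (Detour L) X≡ X-detour
    ; linked = subst (λ Z → Linked E (_ ∷ Z)) X≡ (neighbour-linked vx₁) }

  stem-spoke : ∀ {y} (iy : InVΥ G L Υ y) → E e y → root y ≢ u → Spoke (root y) (Stem.T (stem iy))
  stem-spoke {y} iy ey r≢u = record
    { detour = detour-++ detour e-detour
                         λ { (e∈T , here refl) → disjoint (root y) u r∈ u∈L r≢u e
                                                          (All.lookup inside e∈T) (X⊆Υu e∈X) }
    ; linked = subst (Linked E) (sym (trans (cong (_++ [ e ]) ends) (++-assoc S [ y ] [ e ])))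
                     (linked-glue S linked (edge-sym ey ∷ [-])) }
    where
    open Stem (stem iy)
    r∈ : root y ∈ L
    r∈ = proj₁ (root-spec iy)
    e-detour : Detour L [ e ]
    e-detour = record { distinct = [] ∷ [] ; outside = All.lookup (Detour.outside X-detour) e∈X ∷ [] }

  -- Two spokes from distinct vertices of L with disjoint interiors join at e into a
  -- detour between their feet, so the feet are far apart on L.
  spoke-join : ∀ {a b Z Z'} → a ∈ L → b ∈ L → a ≢ b → Spoke a Z → Spoke b Z' → Disjoint Z Z' →
               length Z + suc (length Z') < ∣ pos a - pos b ∣
  spoke-join {a} {b} {Z} {Z'} a∈ b∈ a≢b sa sb Z#Z' =
    subst (_< ∣ pos a - pos b ∣) (trans (length-++ Z) (cong (λ n → length Z + suc n) (length-reverse Z')))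
          (detour-gap a∈ b∈ a≢b (detour-++ (detour-prefix Z (Spoke.detour sa)) back-detour Z#back) joined)
    where
    back : reverse (Z' ++ [ e ]) ≡ e ∷ reverse Z'
    back = reverse-++ Z' [ e ]
    back-detour : Detour L (e ∷ reverse Z')
    back-detour = subst (Detour L) back (detour-reverse (Spoke.detour sb))
    Z#back : Disjoint Z (e ∷ reverse Z')
    Z#back (v∈Z , here refl)   = proj₂ (proj₂ (unique-++⁻ Z (Detour.distinct (Spoke.detour sa)))) (v∈Z , here refl)
    Z#back (v∈Z , there v∈Z'ʳ) = Z#Z' (v∈Z , Any.reverse⁻ v∈Z'ʳ)
    joined : Linked E (a ∷ (Z ++ e ∷ reverse Z') ++ [ b ])
    joined = subst (λ W → Linked E (a ∷ W)) (sym (++-assoc Z (e ∷ reverse Z') [ b ]))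
                   (linked-glue (a ∷ Z) (Spoke.linked sa)
                      (subst (Linked E) (reverse-between b Z' e) (linked-reverse edge-sym (Spoke.linked sb))))

  X₀⊆Υu : ∀ {x} → x ∈ X₀ → x ∈ Υ u
  X₀⊆Υu x∈ = X⊆Υu (subst (_ ∈_) (sym X≡) (∈-++⁺ˡ x∈))

  -- A neighbour y of e with root w ≠ u and a neighbour v ≠ w of x₁ on L are far apart:
  -- the stem of y, e and X read backwards form a detour from w to v.
  stem-vs-neighbour : ∀ {y v} (iy : InVΥ G L Υ y) → E e y → root y ≢ u → v ∈ L → E v x₁ → root y ≢ v →
                      depth y + k < ∣ pos (root y) - pos v ∣
  stem-vs-neighbour {y} {v} iy ey r≢u v∈ vx₁ r≢v =
    subst (_< ∣ pos (root y) - pos v ∣) (cong₂ _+_ length≡ (sym k≡))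
          (spoke-join (proj₁ (root-spec iy)) v∈ r≢v (stem-spoke iy ey r≢u) (neighbour-spoke vx₁)
                      λ (x∈T , x∈X₀) → disjoint (root y) u (proj₁ (root-spec iy)) u∈L r≢u _
                                                (All.lookup inside x∈T) (X₀⊆Υu x∈X₀))
    where open Stem (stem iy)

  -- Two neighbours of e with distinct roots other than u are far apart: their stems
  -- joined at e form a detour between the roots.
  stem-vs-stem : ∀ {y y'} (iy : InVΥ G L Υ y) (iy' : InVΥ G L Υ y') → E e y → E e y' →
                 root y ≢ u → root y' ≢ u → root y ≢ root y' →
                 depth y + suc (depth y') < ∣ pos (root y) - pos (root y') ∣
  stem-vs-stem {y} {y'} iy iy' ey ey' r≢u r'≢u r≢r' =
    subst (_< ∣ pos (root y) - pos (root y') ∣)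
          (cong₂ (λ a b → a + suc b) (Stem.length≡ (stem iy)) (Stem.length≡ (stem iy')))
          (spoke-join (proj₁ (root-spec iy)) (proj₁ (root-spec iy')) r≢r'
                      (stem-spoke iy ey r≢u) (stem-spoke iy' ey' r'≢u)
                      λ (x∈T , x∈T') → disjoint (root y) (root y') (proj₁ (root-spec iy)) (proj₁ (root-spec iy'))
                                                r≢r' _ (All.lookup (Stem.inside (stem iy)) x∈T)
                                                (All.lookup (Stem.inside (stem iy')) x∈T'))

  mid-depth : ∀ {y} → InVΥ G L Υ y → E e y → root y ≡ u → depth y < k
  mid-depth {y} iy ey r≡u with indexOf-split _≟_ (subst (λ w → y ∈ Υ w) r≡u (proj₂ (root-spec iy)))
  ... | P , Q , Υu≡PyQ , lenP =
    subst (_< k) (trans lenP (cong (λ w → indexOf _≟_ y (Υ w)) (sym r≡u)))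
          (≤∧≢⇒< (subst (length P ≤_) (sym k≡) P≤) P≢)
    where
    uX₀e≡PyQ : (u ∷ X₀) ++ e ∷ [] ≡ P ++ y ∷ Q
    uX₀e≡PyQ = trans (cong (u ∷_) (sym X≡)) (trans (sym Υu≡) Υu≡PyQ)
    lengths : suc (length X₀) + 1 ≡ length P + suc (length Q)
    lengths = trans (sym (length-++ (u ∷ X₀))) (trans (cong length uX₀e≡PyQ) (length-++ P))
    P≤ : length P ≤ suc (length X₀)
    P≤ = +-cancelʳ-≤ 1 _ _ (subst (length P + 1 ≤_) (sym lengths) (+-monoʳ-≤ (length P) (s≤s z≤n)))
    P≢ : length P ≢ k
    P≢ P≡k = edge-irrefl (subst (E e) (sym (split-same (u ∷ X₀) P uX₀e≡PyQ (sym (trans P≡k k≡)))) ey)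

  B≢u : ∀ {v} → InU₀ G L Υ v → v ≢ u
  B≢u (_ , v≡v̈) refl = u≢ü v≡v̈

  pos-≢ : ∀ {a b} → a ∈ L → b ∈ L → a ≢ b → pos a ≢ pos b
  pos-≢ a∈ b∈ a≢b same = a≢b (pos-injective a∈ b∈ same)

  rooted-in-U₀ : ∀ {y v} → InVΥ G L Υ y → InU₀ G L Υ v → root y ≡ v → depth y ≡ 0
  rooted-in-U₀ {y} {v} iy v∈U₀ r≡v = begin
    depth y                 ≡⟨ cong (λ w → indexOf _≟_ y (Υ w)) r≡v ⟩
    indexOf _≟_ y (Υ v)     ≡⟨ cong (indexOf _≟_ y) (trivial-tooth v∈U₀) ⟩
    indexOf _≟_ y [ v ]     ≡⟨ cong (λ w → indexOf _≟_ w [ v ]) y≡v ⟩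
    indexOf _≟_ v [ v ]     ≡⟨ indexOf-head _≟_ v [] ⟩
    0                       ∎
    where
    open ≡-Reasoning
    y≡v : y ≡ v
    y≡v with subst (y ∈_) (trivial-tooth v∈U₀) (subst (λ w → y ∈ Υ w) r≡v (proj₂ (root-spec iy)))
    ... | here y≡v = y≡v

  depth-at-U₀ : ∀ {y v} → InVΥ G L Υ y → InU₀ G L Υ v → pos (root y) ≡ pos v → depth y ≢ k
  depth-at-U₀ iy v∈U₀@(v∈ , _) r≡q d≡k =
    0≢1+n (trans (sym (rooted-in-U₀ iy v∈U₀ (pos-injective (proj₁ (root-spec iy)) v∈ r≡q))) (trans d≡k k≡))

  Target : V G ⊎ V G → Set
  Target (inj₁ y) = E e y × InVΥ G L Υ y
  Target (inj₂ v) = InU₀ G L Υ v × E v x₁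

  position offset : V G ⊎ V G → ℕ
  position (inj₁ y) = pos (root y)
  position (inj₂ v) = pos v
  offset (inj₁ y) = depth y
  offset (inj₂ v) = k

  -- X hangs off u, so it fits on both sides of u: k ≤ p and p + k < m.
  u-bounds : k ≤ pos u × pos u + k < length L
  u-bounds = tail-bounds u∈L X-detour u-linked

  open Slots (length L) (pos u) k (≤-<-trans (m≤m+n (pos u) k) (proj₂ u-bounds)) (proj₁ u-bounds)

  place : ∀ {t} → Target t → Place (position t) (offset t)
  place {inj₁ y} (ey , iy) with root y ≟ u
  ... | yes r≡u = at (cong pos r≡u) (mid-depth iy ey r≡u)
  ... | no  r≢u = place-off (pos-≢ r∈ u∈L r≢u)
                            (subst (_≤ pos (root y)) length≡ (proj₁ bounds))
                            (subst (λ j → pos (root y) + j < length L) length≡ (proj₂ bounds))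
                            (below-gap (depth y) (subst (_< ∣ pos (root y) - pos u ∣) (+-comm (depth y) k)
                                                        (stem-vs-neighbour iy ey r≢u u∈L u-x₁ r≢u)))
    where
    open Stem (stem iy)
    r∈ : root y ∈ L
    r∈ = proj₁ (root-spec iy)
    bounds : length T ≤ pos (root y) × pos (root y) + length T < length L
    bounds = tail-bounds r∈ detour (subst (Linked E) (sym ends) linked)
  place {inj₂ v} (v∈U₀@(v∈ , _) , vx₁) =
    place-off v≢p (proj₁ bounds) (proj₂ bounds) (distinct-gap k v≢p)
    where
    v≢p : pos v ≢ pos u
    v≢p = pos-≢ v∈ u∈L (B≢u v∈U₀)
    bounds : k ≤ pos v × pos v + k < length L
    bounds = tail-bounds v∈ X-detour (neighbour-linked vx₁)

  separated : ∀ {t t'} → Target t → Target t' → position t ≢ pos u → position t' ≢ pos u →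
              position t ≢ position t' → offset t < ∣ position t - position t' ∣ + offset t'
  separated {inj₁ y} {inj₁ y'} (ey , iy) (ey' , iy') r≢p r'≢p r≢r' =
    below-gap (depth y') (stem-vs-stem iy iy' ey ey' (λ { refl → r≢p refl }) (λ { refl → r'≢p refl })
                                       (λ r≡r' → r≢r' (cong pos r≡r')))
  separated {inj₁ y} {inj₂ v} (ey , iy) ((v∈ , _) , vx₁) r≢p _ r≢v =
    below-gap k (stem-vs-neighbour iy ey (λ { refl → r≢p refl }) v∈ vx₁ (λ r≡v → r≢v (cong pos r≡v)))
  separated {inj₂ v} {inj₁ y} ((v∈ , _) , vx₁) (ey , iy) _ r≢p v≢r =
    below-gap (depth y) (subst₂ _<_ (+-comm (depth y) k) (∣-∣-comm (pos (root y)) (pos v))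
      (stem-vs-neighbour iy ey (λ { refl → r≢p refl }) v∈ vx₁ (λ r≡v → v≢r (sym (cong pos r≡v)))))
  separated {inj₂ v} {inj₂ v'} _ _ _ _ v≢v' = distinct-gap k v≢v'

  determined : ∀ {t t'} → Target t → Target t' → position t ≡ position t' → offset t ≡ offset t' → t ≡ t'
  determined {inj₁ y} {inj₁ y'} (_ , iy) (_ , iy') r≡ d≡ =
    cong inj₁ (root-depth-injective iy iy' (pos-injective (proj₁ (root-spec iy)) (proj₁ (root-spec iy')) r≡) d≡)
  determined {inj₂ v} {inj₂ v'} ((v∈ , _) , _) ((v'∈ , _) , _) q≡ _ = cong inj₂ (pos-injective v∈ v'∈ q≡)
  determined {inj₁ y} {inj₂ v} (_ , iy) (v∈U₀ , _) r≡ d≡ = ⊥-elim (depth-at-U₀ iy v∈U₀ r≡ d≡)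
  determined {inj₂ v} {inj₁ y} (v∈U₀ , _) (_ , iy) r≡ d≡ = ⊥-elim (depth-at-U₀ iy v∈U₀ (sym r≡) (sym d≡))

  W-list B-list : List (V G)
  W-list = filter (λ x → Edge? G e x ×-dec InVΥ? G L Υ x) (allFin (Graph.n G))
  B-list = filter (λ v → InU₀? G L Υ v ×-dec Edge? G v x₁) (allFin (Graph.n G))

  targets : List (V G ⊎ V G)
  targets = map inj₁ W-list ++ map inj₂ B-list

  targets-unique : Unique targets
  targets-unique = Unique.++⁺ (Unique.map⁺ inj₁-injective (Unique.filter⁺ _ (Unique.allFin⁺ _)))
                              (Unique.map⁺ inj₂-injective (Unique.filter⁺ _ (Unique.allFin⁺ _)))
                              λ (t∈W , t∈B) → inj₁≢inj₂ t∈W t∈B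
    where
    inj₁≢inj₂ : ∀ {t} → t ∈ map inj₁ W-list → t ∈ map inj₂ B-list → ⊥
    inj₁≢inj₂ t∈W t∈B with ∈-map⁻ inj₁ t∈W | ∈-map⁻ inj₂ t∈B
    ... | _ , _ , refl | _ , _ , ()

  target : ∀ {t} → t ∈ targets → Target t
  target t∈ with ∈-++⁻ (map inj₁ W-list) t∈
  ... | inj₁ t∈W with ∈-map⁻ inj₁ t∈W
  ...   | y , y∈ , refl = proj₂ (∈-filter⁻ _ {xs = allFin _} y∈)
  target t∈ | inj₂ t∈B with ∈-map⁻ inj₂ t∈B
  ...   | v , v∈ , refl = proj₂ (∈-filter⁻ _ {xs = allFin _} v∈)

  φ+b≤|L| : φ G L Υ u + b G L Υ u ≤ pathLength G L
  φ+b≤|L| = subst (_≤ pathLength G L)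
    (trans (length-++ (map inj₁ W-list)) (cong₂ _+_ (length-map inj₁ W-list) (length-map inj₂ B-list)))
    (placed-count targets position offset targets-unique (place ∘ target)
                  (λ t∈ t'∈ → separated (target t∈) (target t'∈))
                  (λ t∈ t'∈ → determined (target t∈) (target t'∈)))

lemma3 : (G : Graph) (H : Subset (Graph.n G)) (L : List (V G)) (Υ : V G → List (V G))
         → IsLongestPath G H L
         → IsMinimalSpreading G H L Υ
         → ∀ u → u ∈ L → u ≢ endOf G Υ u
         → φ G L Υ u + b G L Υ u ≤ pathLength G L
lemma3 G H L Υ longest minimal u u∈L u≢ü =
  let spreading = IsMinimalSpreading.spreading minimal
      X' , X₀ , Υu≡ , X≡ = nontrivial-tooth G (Υ u) (IsSpreading.starts spreading u u∈L) u≢ü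
  in Lemma3.φ+b≤|L| G H longest spreading u∈L u≢ü Υu≡ X≡
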